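{- Let $G$ be an undirected graph on vertex set $\{r,1,\dots,n-1\}$ with non-negative edge weights, and suppose $G$ contains the star spanning tree $T$ with edges $e_i=(r,i)$, $i=1,\dots,n-1$. Assume that no minimum 2-respecting cut (with respect to $T$) contains only one edge of $T$. Let $(e_i,e_j)$, $i\neq j$, be a pair minimizing $\mathsf{cut}(e_i,e_j)$ over all pairs of distinct tree edges. Then $\deg(i)<2C(i,j)$ and $\deg(j)<2C(i,j)$.
   Context: $\deg(u)$ is the total weight of edges incident to vertex $u$, and $C(u,v)$ is the weight of the edge $(u,v)$ ($0$ if absent). For tree edges $e,f$, $\mathsf{cut}(e,f)$ is the total weight of edges $(u,v)$ of $G$ such that the unique $u$–$v$ path in $T$ contains exactly one of $e$ and $f$; for the star, $\mathsf{cut}(e_i,e_j)=\deg(i)+\deg(j)-2C(i,j)$. A cut $(S,V\setminus S)$ 2-respects $T$ if at most two edges of $T$ cross it; a minimum 2-respecting cut is one of minimum weight among such cuts.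
   Formalization: The non-negative edge weights of G are rational rather than real. -}

module Defs where

open import Data.Nat using (ℕ; zero; suc)
open import Data.Fin using (Fin; zero; suc)
open import Data.Bool using (Bool; true; false; if_then_else_)
open import Data.Rational using (ℚ; 0ℚ; 1ℚ; _+_; _-_; _*_; _≤_; _<_)
open import Data.Product using (_×_; Σ; ∃)
open import Relation.Binary.PropositionalEquality using (_≡_; _≢_)

sumFin : (n : ℕ) → (Fin n → ℚ) → ℚ
sumFin zero    f = 0ℚ
sumFin (suc n) f = f zero + sumFin n (λ i → f (suc i))

countFin : (n : ℕ) → (Fin n → Bool) → ℕ
countFin zero    p = 0
countFin (suc n) p = (if p zero then 1 else 0) Data.Nat.+ countFin n (λ i → p (suc i))

-- A weighted undirected graph on vertex set Fin (suc m):
-- vertex 'zero' plays the role of r, 'suc i' the role of vertex i+1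
-- (so n = suc m vertices; tree edges e_i = (r, i) are indexed by Fin m).
-- C u v is the weight of edge (u,v) (0 if absent).
record WGraph (m : ℕ) : Set where
  field
    C       : Fin (suc m) → Fin (suc m) → ℚ
    nonneg  : ∀ u v → 0ℚ ≤ C u v
    symm    : ∀ u v → C u v ≡ C v u
    noLoops : ∀ u → C u u ≡ 0ℚ
open WGraph public

module _ {m : ℕ} (G : WGraph m) where
  V : Set
  V = Fin (suc m)

  root : V
  root = zero

  deg : V → ℚ
  deg u = sumFin (suc m) (λ v → C G u v)

  Cut : Set
  Cut = V → Bool

  cutWeight : Cut → ℚ
  cutWeight S = sumFin (suc m) (λ u → sumFin (suc m) (λ v →
                  if S u then (if S v then 0ℚ else C G u v) else 0ℚ))

  differ : Bool → Bool → Bool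
  differ true  true  = false
  differ false false = false
  differ _     _     = true

  treeEdgesCrossing : Cut → ℕ
  treeEdgesCrossing S = countFin m (λ i → differ (S root) (S (suc i)))

  Nontrivial : Cut → Set
  Nontrivial S = ∃ (λ u → S u ≡ true) × ∃ (λ v → S v ≡ false)

  TwoRespecting : Cut → Set
  TwoRespecting S = Nontrivial S × (treeEdgesCrossing S Data.Nat.≤ 2)

  MinTwoRespecting : Cut → Set
  MinTwoRespecting S = TwoRespecting S × (∀ S' → TwoRespecting S' → cutWeight S ≤ cutWeight S')

  starCut : Fin m → Fin m → ℚ
  starCut i j = deg (suc i) + deg (suc j) - (1ℚ + 1ℚ) * C G (suc i) (suc j)

-- Suppose deg(i) ≥ 2C(i,j), so that cut(e_i,e_j) ≥ deg(j), and let k be a non-root vertex of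
-- minimum degree. Seen from its side A avoiding r, a 2-respecting cut has A = {k'} or
-- A = {k',l'}; as cut(A) = Σ_{u∈A} deg(u) − Σ_{u,v∈A} C(u,v), its weight is deg(k') or
-- cut(e_k',e_l'), and both are at least deg(k). Hence the cut {k}, of weight deg(k), is a
-- minimum 2-respecting cut containing only the tree edge e_k, against the hypothesis.
-- The bound for deg(j) is symmetric.
module Submission where

open import Defs
open import Data.Nat using (ℕ)
open import Data.Fin using (Fin; suc)
open import Data.Rational using (_+_; _*_; _<_; _≤_; 1ℚ)
open import Data.Product using (_×_)
open import Relation.Binary.PropositionalEquality using (_≡_; _≢_)

open import Data.Bool using (Bool; true; false; not; _∨_; if_then_else_)
open import Data.Empty using (⊥-elim)
open import Data.Fin using (zero)
open import Data.Fin.Properties using (_≟_; suc-injective)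
open import Data.List using (allFin)
open import Data.List.Membership.Propositional.Properties using (∈-allFin)
open import Data.List.Relation.Unary.All using (lookup)
open import Data.Nat using (zero; suc; s≤s; pred)
import Data.Nat as ℕ
open import Data.Product using (_,_; ∃-syntax)
open import Data.Rational using (ℚ; 0ℚ; _-_)
open import Data.Rational.Properties
  using (+-0-commutativeMonoid; ≤-decTotalOrder; +-identityˡ; +-identityʳ; +-comm; +-monoˡ-<; ≤-trans;
         _≤?_; ≰⇒>)
open import Data.Rational.Solver using (module +-*-Solver)
open import Function using (_∘_)
open import Relation.Binary.Bundles using (DecTotalOrder)
open import Relation.Binary.PropositionalEquality
  using (_≗_; refl; sym; trans; cong; cong₂; subst; subst₂; module ≡-Reasoning)
open import Relation.Nullary using (yes; no; does)
open import Relation.Nullary.Decidable using (dec-true)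

open import Algebra.Properties.CommutativeMonoid.Sum +-0-commutativeMonoid
  using (sum; sum-cong-≗; ∑-distrib-+; ∑-comm; sum-replicate-zero)
open import Data.List.Extrema (DecTotalOrder.totalOrder ≤-decTotalOrder)
  using (argmin; f[argmin]≤f[xs])
open +-*-Solver
open ≡-Reasoning

x≡x+y-y : ∀ x y → x ≡ x + y - y
x≡x+y-y = solve 2 (λ x y → x := x :+ y :- y) refl

a+b-t<b⇒a<t : ∀ a b t → a + b - t < b → a < t
a+b-t<b⇒a<t a b t a+b-t<b = subst₂ _<_
  (solve 3 (λ a b t → a :+ b :- t :+ (t :- b) := a) refl a b t)
  (solve 2 (λ b t → b :+ (t :- b) := t) refl b t)
  (+-monoˡ-< (t - b) a+b-t<b)

a+b-t<a⇒b<t : ∀ a b t → a + b - t < a → b < t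
a+b-t<a⇒b<t a b t a+b-t<a = a+b-t<b⇒a<t b a t (subst (_< a) (cong (_- t) (+-comm a b)) a+b-t<a)

sumFin≡sum : ∀ n (f : Fin n → ℚ) → sumFin n f ≡ sum f
sumFin≡sum zero    f = refl
sumFin≡sum (suc n) f = cong (f zero +_) (sumFin≡sum n (f ∘ suc))

⁅_⁆ : ∀ {n} → Fin n → Fin n → Bool
⁅ k ⁆ i = does (i ≟ k)

infixr 6 _∪_

_∪_ : ∀ {n} → (Fin n → Bool) → (Fin n → Bool) → Fin n → Bool
(p ∪ q) i = p i ∨ q i

restrict : ∀ {n} → (Fin n → Bool) → (Fin n → ℚ) → Fin n → ℚ
restrict p f i = if p i then f i else 0ℚ

sumOver : ∀ {n} → (Fin n → Bool) → (Fin n → ℚ) → ℚ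
sumOver p f = sum (restrict p f)

sumOver-⁅⁆ : ∀ {n} (k : Fin n) (f : Fin n → ℚ) → sumOver ⁅ k ⁆ f ≡ f k
sumOver-⁅⁆ {suc n} zero    f = trans (cong (f zero +_) (sum-replicate-zero n)) (+-identityʳ (f zero))
sumOver-⁅⁆ {suc n} (suc k) f = trans (+-identityˡ _) (sumOver-⁅⁆ k (f ∘ suc))

sumOver-⁅⁆∪⁅⁆ : ∀ {n} {k l : Fin n} → k ≢ l → (f : Fin n → ℚ) → sumOver (⁅ k ⁆ ∪ ⁅ l ⁆) f ≡ f k + f l
sumOver-⁅⁆∪⁅⁆ {k = k} {l} k≢l f = begin
  sumOver (⁅ k ⁆ ∪ ⁅ l ⁆) f                        ≡⟨ sum-cong-≗ split ⟩
  sum (λ i → restrict ⁅ k ⁆ f i + restrict ⁅ l ⁆ f i) ≡⟨ ∑-distrib-+ (restrict ⁅ k ⁆ f) (restrict ⁅ l ⁆ f) ⟩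
  sumOver ⁅ k ⁆ f + sumOver ⁅ l ⁆ f                 ≡⟨ cong₂ _+_ (sumOver-⁅⁆ k f) (sumOver-⁅⁆ l f) ⟩
  f k + f l                                         ∎
  where
  split : ∀ i → restrict (⁅ k ⁆ ∪ ⁅ l ⁆) f i ≡ restrict ⁅ k ⁆ f i + restrict ⁅ l ⁆ f i
  split i with i ≟ k | i ≟ l
  ... | yes refl | yes refl = ⊥-elim (k≢l refl)
  ... | yes _    | no _     = sym (+-identityʳ (f i))
  ... | no _     | yes _    = sym (+-identityˡ (f i))
  ... | no _     | no _     = refl

countFin-cong : ∀ {n} {p q : Fin n → Bool} → p ≗ q → countFin n p ≡ countFin n q
countFin-cong {zero}  p≗q = refl
countFin-cong {suc n} p≗q = cong₂ (λ b c → (if b then 1 else 0) ℕ.+ c) (p≗q zero) (countFin-cong (p≗q ∘ suc))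

countFin-false : ∀ n → countFin n (λ _ → false) ≡ 0
countFin-false zero    = refl
countFin-false (suc n) = countFin-false n

countFin-⁅⁆ : ∀ {n} (k : Fin n) → countFin n ⁅ k ⁆ ≡ 1
countFin-⁅⁆ {suc n} zero    = cong suc (countFin-false n)
countFin-⁅⁆ {suc n} (suc k) = countFin-⁅⁆ k

countFin≡0⇒false : ∀ {n} (p : Fin n → Bool) → countFin n p ≡ 0 → ∀ i → p i ≡ false
countFin≡0⇒false {suc n} p c i with p zero in p₀
countFin≡0⇒false {suc n} p () i       | true
countFin≡0⇒false {suc n} p c zero    | false = p₀
countFin≡0⇒false {suc n} p c (suc i) | false = countFin≡0⇒false (p ∘ suc) c i

countFin≡1⇒⁅⁆ : ∀ {n} (p : Fin n → Bool) → countFin n p ≡ 1 → ∃[ k ] p ≗ ⁅ k ⁆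
countFin≡1⇒⁅⁆ {suc n} p c with p zero in p₀
... | true  = zero , λ { zero → p₀ ; (suc i) → countFin≡0⇒false (p ∘ suc) (cong pred c) i }
... | false with countFin≡1⇒⁅⁆ (p ∘ suc) c
...   | k , p≗⁅k⁆ = suc k , λ { zero → p₀ ; (suc i) → p≗⁅k⁆ i }

countFin≡2⇒⁅⁆∪⁅⁆ : ∀ {n} (p : Fin n → Bool) → countFin n p ≡ 2 → ∃[ k ] ∃[ l ] k ≢ l × p ≗ ⁅ k ⁆ ∪ ⁅ l ⁆
countFin≡2⇒⁅⁆∪⁅⁆ {suc n} p c with p zero in p₀
... | true with countFin≡1⇒⁅⁆ (p ∘ suc) (cong pred c)
...   | l , p≗⁅l⁆ = zero , suc l , (λ ()) , λ { zero → p₀ ; (suc i) → p≗⁅l⁆ i }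
countFin≡2⇒⁅⁆∪⁅⁆ {suc n} p c | false with countFin≡2⇒⁅⁆∪⁅⁆ (p ∘ suc) c
...   | k , l , k≢l , p≗⁅k⁆∪⁅l⁆ = suc k , suc l , k≢l ∘ suc-injective , λ { zero → p₀ ; (suc i) → p≗⁅k⁆∪⁅l⁆ i }

-- leaving (S u) (S v) (C G u v) is literally the summand of cutWeight G S.
leaving : Bool → Bool → ℚ → ℚ
leaving a b c = if a then (if b then 0ℚ else c) else 0ℚ

leaving-not : ∀ a b c → leaving (not b) (not a) c ≡ leaving a b c
leaving-not true  true  c = refl
leaving-not true  false c = refl
leaving-not false true  c = refl
leaving-not false false c = refl

leaving+staying : ∀ b c → leaving true b c + (if b then c else 0ℚ) ≡ c
leaving+staying true  c = +-identityˡ c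
leaving+staying false c = +-identityʳ c

module _ {m : ℕ} (G : WGraph m) where

  internalWeight : Cut G → ℚ
  internalWeight A = sumOver A (λ u → sumOver A (C G u))

  cutWeight≡∑∑ : ∀ S → cutWeight G S ≡ sum (λ u → sum (λ v → leaving (S u) (S v) (C G u v)))
  cutWeight≡∑∑ S = begin
    cutWeight G S
      ≡⟨ sumFin≡sum (suc m) (λ u → sumFin (suc m) (λ v → leaving (S u) (S v) (C G u v))) ⟩
    sum (λ u → sumFin (suc m) (λ v → leaving (S u) (S v) (C G u v)))
      ≡⟨ sum-cong-≗ (λ u → sumFin≡sum (suc m) (λ v → leaving (S u) (S v) (C G u v))) ⟩
    sum (λ u → sum (λ v → leaving (S u) (S v) (C G u v)))
      ∎

  cutWeight-cong : ∀ {S S′} → S ≗ S′ → cutWeight G S ≡ cutWeight G S′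
  cutWeight-cong {S} {S′} S≗S′ = begin
    cutWeight G S
      ≡⟨ cutWeight≡∑∑ S ⟩
    sum (λ u → sum (λ v → leaving (S u) (S v) (C G u v)))
      ≡⟨ sum-cong-≗ (λ u → sum-cong-≗ (λ v → cong₂ (λ a b → leaving a b (C G u v)) (S≗S′ u) (S≗S′ v))) ⟩
    sum (λ u → sum (λ v → leaving (S′ u) (S′ v) (C G u v)))
      ≡⟨ cutWeight≡∑∑ S′ ⟨
    cutWeight G S′
      ∎

  cutWeight-complement : ∀ S → cutWeight G (not ∘ S) ≡ cutWeight G S
  cutWeight-complement S = begin
    cutWeight G (not ∘ S)
      ≡⟨ cutWeight≡∑∑ (not ∘ S) ⟩
    sum (λ u → sum (λ v → leaving (not (S u)) (not (S v)) (C G u v)))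
      ≡⟨ ∑-comm (λ u v → leaving (not (S u)) (not (S v)) (C G u v)) ⟩
    sum (λ v → sum (λ u → leaving (not (S u)) (not (S v)) (C G u v)))
      ≡⟨ sum-cong-≗ (λ v → sum-cong-≗ (λ u → reversed u v)) ⟩
    sum (λ v → sum (λ u → leaving (S v) (S u) (C G v u)))
      ≡⟨ cutWeight≡∑∑ S ⟨
    cutWeight G S
      ∎
    where
    reversed : ∀ u v → leaving (not (S u)) (not (S v)) (C G u v) ≡ leaving (S v) (S u) (C G v u)
    reversed u v =
      trans (cong (leaving (not (S u)) (not (S v))) (symm G u v)) (leaving-not (S v) (S u) (C G v u))

  cutWeight+internalWeight : ∀ A → cutWeight G A + internalWeight A ≡ sumOver A (deg G)
  cutWeight+internalWeight A = begin
    cutWeight G A + internalWeight A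
      ≡⟨ cong (_+ internalWeight A) (cutWeight≡∑∑ A) ⟩
    sum (λ u → sum (λ v → leaving (A u) (A v) (C G u v))) + internalWeight A
      ≡⟨ ∑-distrib-+ (λ u → sum (λ v → leaving (A u) (A v) (C G u v))) (restrict A (λ u → sumOver A (C G u))) ⟨
    sum (λ u → sum (λ v → leaving (A u) (A v) (C G u v)) + restrict A (λ u → sumOver A (C G u)) u)
      ≡⟨ sum-cong-≗ atVertex ⟩
    sumOver A (deg G)
      ∎
    where
    atVertex : ∀ u → sum (λ v → leaving (A u) (A v) (C G u v)) + restrict A (λ u → sumOver A (C G u)) u
                     ≡ restrict A (deg G) u
    atVertex u with A u
    ... | false = trans (+-identityʳ _) (sum-replicate-zero (suc m))
    ... | true  = begin
      sum (λ v → leaving true (A v) (C G u v)) + sumOver A (C G u)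
        ≡⟨ ∑-distrib-+ (λ v → leaving true (A v) (C G u v)) (restrict A (C G u)) ⟨
      sum (λ v → leaving true (A v) (C G u v) + restrict A (C G u) v)
        ≡⟨ sum-cong-≗ (λ v → leaving+staying (A v) (C G u v)) ⟩
      sum (C G u)
        ≡⟨ sumFin≡sum (suc m) (C G u) ⟨
      deg G u
        ∎

  cutWeight≡degrees-internal : ∀ A → cutWeight G A ≡ sumOver A (deg G) - internalWeight A
  cutWeight≡degrees-internal A =
    trans (x≡x+y-y (cutWeight G A) (internalWeight A)) (cong (_- internalWeight A) (cutWeight+internalWeight A))

  cutWeight-⁅⁆ : ∀ K → cutWeight G ⁅ K ⁆ ≡ deg G K
  cutWeight-⁅⁆ K = begin
    cutWeight G ⁅ K ⁆                                ≡⟨ cutWeight≡degrees-internal ⁅ K ⁆ ⟩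
    sumOver ⁅ K ⁆ (deg G) - internalWeight ⁅ K ⁆     ≡⟨ cong₂ _-_ (sumOver-⁅⁆ K (deg G)) internal≡0 ⟩
    deg G K - 0ℚ                                     ≡⟨ +-identityʳ (deg G K) ⟩
    deg G K                                          ∎
    where
    internal≡0 : internalWeight ⁅ K ⁆ ≡ 0ℚ
    internal≡0 = trans (sumOver-⁅⁆ K (λ u → sumOver ⁅ K ⁆ (C G u)))
                       (trans (sumOver-⁅⁆ K (C G K)) (noLoops G K))

  internalWeight-⁅⁆∪⁅⁆ : ∀ {K L} → K ≢ L → internalWeight (⁅ K ⁆ ∪ ⁅ L ⁆) ≡ (1ℚ + 1ℚ) * C G K L
  internalWeight-⁅⁆∪⁅⁆ {K} {L} K≢L = begin
    internalWeight (⁅ K ⁆ ∪ ⁅ L ⁆)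
      ≡⟨ sumOver-⁅⁆∪⁅⁆ K≢L (λ u → sumOver (⁅ K ⁆ ∪ ⁅ L ⁆) (C G u)) ⟩
    sumOver (⁅ K ⁆ ∪ ⁅ L ⁆) (C G K) + sumOver (⁅ K ⁆ ∪ ⁅ L ⁆) (C G L)
      ≡⟨ cong₂ _+_ (sumOver-⁅⁆∪⁅⁆ K≢L (C G K)) (sumOver-⁅⁆∪⁅⁆ K≢L (C G L)) ⟩
    (C G K K + C G K L) + (C G L K + C G L L)
      ≡⟨ cong₂ (λ x y → (x + C G K L) + y) (noLoops G K) (cong₂ _+_ (symm G L K) (noLoops G L)) ⟩
    (0ℚ + C G K L) + (C G K L + 0ℚ)
      ≡⟨ solve 1 (λ c → (con 0ℚ :+ c) :+ (c :+ con 0ℚ) := (con 1ℚ :+ con 1ℚ) :* c) refl (C G K L) ⟩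
    (1ℚ + 1ℚ) * C G K L
      ∎

  cutWeight-⁅⁆∪⁅⁆ : ∀ {K L} → K ≢ L → cutWeight G (⁅ K ⁆ ∪ ⁅ L ⁆) ≡ deg G K + deg G L - (1ℚ + 1ℚ) * C G K L
  cutWeight-⁅⁆∪⁅⁆ {K} {L} K≢L = begin
    cutWeight G (⁅ K ⁆ ∪ ⁅ L ⁆)
      ≡⟨ cutWeight≡degrees-internal (⁅ K ⁆ ∪ ⁅ L ⁆) ⟩
    sumOver (⁅ K ⁆ ∪ ⁅ L ⁆) (deg G) - internalWeight (⁅ K ⁆ ∪ ⁅ L ⁆)
      ≡⟨ cong₂ _-_ (sumOver-⁅⁆∪⁅⁆ K≢L (deg G)) (internalWeight-⁅⁆∪⁅⁆ K≢L) ⟩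
    deg G K + deg G L - (1ℚ + 1ℚ) * C G K L
      ∎

  differ-self : ∀ b → differ G b b ≡ false
  differ-self true  = refl
  differ-self false = refl

  differ-falseˡ : ∀ b → differ G false b ≡ b
  differ-falseˡ true  = refl
  differ-falseˡ false = refl

  differ-trueˡ : ∀ b → differ G true b ≡ not b
  differ-trueˡ true  = refl
  differ-trueˡ false = refl

  differ≡false⇒≡ : ∀ a b → differ G a b ≡ false → a ≡ b
  differ≡false⇒≡ true  true  _ = refl
  differ≡false⇒≡ false false _ = refl

  cutWeight-differ : ∀ b S → cutWeight G (λ v → differ G b (S v)) ≡ cutWeight G S
  cutWeight-differ false S = cutWeight-cong (differ-falseˡ ∘ S)
  cutWeight-differ true  S = trans (cutWeight-cong (differ-trueˡ ∘ S)) (cutWeight-complement S)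

  -- The side of S not containing r; treeEdgesCrossing S counts its non-root vertices.
  farSide : Cut G → Cut G
  farSide S v = differ G (S (root G)) (S v)

  farSide-≗ : ∀ {S A} → A (root G) ≡ false → (∀ i → farSide S (suc i) ≡ A (suc i)) → farSide S ≗ A
  farSide-≗ {S} A₀ far≗ zero    = trans (differ-self (S zero)) (sym A₀)
  farSide-≗     A₀ far≗ (suc i) = far≗ i

  cutWeight≡deg : ∀ S {k} → (∀ i → farSide S (suc i) ≡ ⁅ k ⁆ i) → cutWeight G S ≡ deg G (suc k)
  cutWeight≡deg S {k} far≗ = begin
    cutWeight G S           ≡⟨ cutWeight-differ (S (root G)) S ⟨
    cutWeight G (farSide S) ≡⟨ cutWeight-cong (farSide-≗ {S} {⁅ suc k ⁆} refl far≗) ⟩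
    cutWeight G ⁅ suc k ⁆   ≡⟨ cutWeight-⁅⁆ (suc k) ⟩
    deg G (suc k)           ∎

  cutWeight≡starCut : ∀ S {k l} → k ≢ l → (∀ i → farSide S (suc i) ≡ (⁅ k ⁆ ∪ ⁅ l ⁆) i) →
                      cutWeight G S ≡ starCut G k l
  cutWeight≡starCut S {k} {l} k≢l far≗ = begin
    cutWeight G S                         ≡⟨ cutWeight-differ (S (root G)) S ⟨
    cutWeight G (farSide S)               ≡⟨ cutWeight-cong (farSide-≗ {S} {⁅ suc k ⁆ ∪ ⁅ suc l ⁆} refl far≗) ⟩
    cutWeight G (⁅ suc k ⁆ ∪ ⁅ suc l ⁆)   ≡⟨ cutWeight-⁅⁆∪⁅⁆ (k≢l ∘ suc-injective) ⟩
    starCut G k l                         ∎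

  nontrivial⇒crossing≢0 : ∀ S → Nontrivial G S → treeEdgesCrossing G S ≢ 0
  nontrivial⇒crossing≢0 S ((u , Su) , (v , Sv)) crossing≡0
    with trans (sym Su) (trans (≡root u) (trans (sym (≡root v)) Sv))
    where
    ≡root : ∀ x → S x ≡ S (root G)
    ≡root zero    = refl
    ≡root (suc i) = sym (differ≡false⇒≡ _ _ (countFin≡0⇒false (farSide S ∘ suc) crossing≡0 i))
  ... | ()

  twoRespecting-lowerBound : ∀ {b} → (∀ k → b ≤ deg G (suc k)) → (∀ k l → k ≢ l → b ≤ starCut G k l) →
                             ∀ S → TwoRespecting G S → b ≤ cutWeight G S
  twoRespecting-lowerBound {b} b≤deg b≤starCut S (nontrivial , crossing≤2) = bound _ refl crossing≤2
    where
    bound : ∀ c → treeEdgesCrossing G S ≡ c → c ℕ.≤ 2 → b ≤ cutWeight G S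
    bound 0 crossing≡0 _ = ⊥-elim (nontrivial⇒crossing≢0 S nontrivial crossing≡0)
    bound 1 crossing≡1 _ with countFin≡1⇒⁅⁆ (farSide S ∘ suc) crossing≡1
    ... | k , far≗ = subst (b ≤_) (sym (cutWeight≡deg S far≗)) (b≤deg k)
    bound 2 crossing≡2 _ with countFin≡2⇒⁅⁆∪⁅⁆ (farSide S ∘ suc) crossing≡2
    ... | k , l , k≢l , far≗ = subst (b ≤_) (sym (cutWeight≡starCut S k≢l far≗)) (b≤starCut k l k≢l)
    bound (suc (suc (suc _))) _ (s≤s (s≤s ()))

  treeEdgesCrossing-⁅⁆ : ∀ k → treeEdgesCrossing G ⁅ suc k ⁆ ≡ 1
  treeEdgesCrossing-⁅⁆ k = trans (countFin-cong (differ-falseˡ ∘ ⁅ k ⁆)) (countFin-⁅⁆ k)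

  lightVertex⇒singleEdgeMinCut : ∀ x → (∀ k l → k ≢ l → deg G (suc x) ≤ starCut G k l) →
                                 ∃[ S ] MinTwoRespecting G S × treeEdgesCrossing G S ≡ 1
  lightVertex⇒singleEdgeMinCut x x-light =
    ⁅ suc k₀ ⁆ , (twoRespecting , minimal) , treeEdgesCrossing-⁅⁆ k₀
    where
    k₀ : Fin m
    k₀ = argmin (λ k → deg G (suc k)) x (allFin m)

    k₀-min : ∀ k → deg G (suc k₀) ≤ deg G (suc k)
    k₀-min k = lookup (f[argmin]≤f[xs] {f = λ k → deg G (suc k)} x (allFin m)) (∈-allFin k)

    twoRespecting : TwoRespecting G ⁅ suc k₀ ⁆
    twoRespecting = ((suc k₀ , dec-true (k₀ ≟ k₀) refl) , (zero , refl))
                  , subst (ℕ._≤ 2) (sym (treeEdgesCrossing-⁅⁆ k₀)) (s≤s ℕ.z≤n)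

    minimal : ∀ S → TwoRespecting G S → cutWeight G ⁅ suc k₀ ⁆ ≤ cutWeight G S
    minimal S S-twoRespecting = subst (_≤ cutWeight G S) (sym (cutWeight-⁅⁆ (suc k₀)))
      (twoRespecting-lowerBound {deg G (suc k₀)} k₀-min
        (λ k l k≢l → ≤-trans (k₀-min x) (x-light k l k≢l)) S S-twoRespecting)

  minStarCut<deg : (∀ S → MinTwoRespecting G S → treeEdgesCrossing G S ≢ 1) →
                   ∀ {i j} → (∀ k l → k ≢ l → starCut G i j ≤ starCut G k l) →
                   ∀ x → starCut G i j < deg G (suc x)
  minStarCut<deg noSingleEdgeMinCut {i} {j} ij-min x with deg G (suc x) ≤? starCut G i j
  ... | no  deg≰ = ≰⇒> deg≰
  ... | yes deg≤ =
    let S , S-min , crossing≡1 = lightVertex⇒singleEdgeMinCut x (λ k l k≢l → ≤-trans deg≤ (ij-min k l k≢l))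
    in  ⊥-elim (noSingleEdgeMinCut S S-min crossing≡1)

-- For i = j the hypotheses are contradictory.
mainTheorem7 : (m : ℕ) (G : WGraph m) →
    (∀ S → MinTwoRespecting G S → treeEdgesCrossing G S ≢ 1) →
    (i j : Fin m) → i ≢ j →
    (∀ k l → k ≢ l → starCut G i j ≤ starCut G k l) →
    (deg G (suc i) < (1ℚ + 1ℚ) * C G (suc i) (suc j)) ×
    (deg G (suc j) < (1ℚ + 1ℚ) * C G (suc i) (suc j))
mainTheorem7 m G noSingleEdgeMinCut i j _ ij-min =
  a+b-t<b⇒a<t _ _ _ (starCut<deg j) , a+b-t<a⇒b<t _ _ _ (starCut<deg i)
  where
  starCut<deg : ∀ x → starCut G i j < deg G (suc x)
  starCut<deg = minStarCut<deg G noSingleEdgeMinCut ij-min
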